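{- Let $(L,\leq_L)$ and $(M,\leq_M)$ be finite posets with linearisations $(\mathcal{L},\preceq_{\mathcal{L}})$ and $(\mathcal{M},\preceq_{\mathcal{M}})$. If $f\colon L^n\to M$ is antitonic, then $\tilde f\colon\mathcal{L}^n\to\mathcal{M}$ (defined in the context) is antitonic.
   Context: For a finite poset $(P,\leq)$, write $x<y$ for $x\leq y$, $x\neq y$. Levels: $P_0=\{x\in P : \nexists y\in P,\ x<y\}$, and $P_i=\{x\in P\setminus(P_0\cup\cdots\cup P_{i-1}) : \nexists y\in P\setminus(P_0\cup\cdots\cup P_{i-1}),\ x<y\}$ for $i\geq1$. Each element $x$ lies in exactly one level, denoted $[x]$. The linearisation of $P$ is the set of nonempty levels, linearly ordered by $[x]\preceq[y]$ iff $x\in P_i$, $y\in P_j$, $j\leq i$. Products are ordered componentwise; a mapping is antitonic if $\vec x\leq\vec y$ implies $f(\vec x)\geq f(\vec y)$. For $f\colon L^n\to M$, $\tilde f([x_1],\dots,[x_n])=\min\{[f(y_1,\dots,y_n)] : y_i\in[x_i] \text{ for all } i\}$, the min taken in $(\mathcal{M},\preceq_{\mathcal{M}})$. -}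

module Defs where

open import Level using (Level; _⊔_) renaming (suc to lsuc)
open import Data.Nat using (ℕ; zero; suc) renaming (_≤_ to _≤ℕ_)
open import Data.Fin using (Fin)
open import Data.Product using (Σ; ∃; _×_; _,_; proj₁)
open import Data.Sum using (_⊎_)
open import Data.Empty using (⊥)
open import Data.List using (List)
open import Data.List.Relation.Unary.Any using (Any)
open import Relation.Nullary using (¬_)
open import Relation.Binary.Bundles using (Poset)

record FinitePoset (c ℓ₁ ℓ₂ : Level) : Set (lsuc (c ⊔ ℓ₁ ⊔ ℓ₂)) where
  field
    poset    : Poset c ℓ₁ ℓ₂
  open Poset poset public
  field
    elements : List Carrier
    complete : ∀ x → Any (x ≈_) elements

module _ {c ℓ₁ ℓ₂} (P : FinitePoset c ℓ₁ ℓ₂) where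
  open FinitePoset P

  _<ₚ_ : Carrier → Carrier → Set (ℓ₁ ⊔ ℓ₂)
  x <ₚ y = (x ≤ y) × ¬ (x ≈ y)

  -- Removed i x  :⇔  x ∈ P_0 ∪ ... ∪ P_{i-1}
  -- InLevel i x  :⇔  x ∈ P_i
  Removed : ℕ → Carrier → Set (c ⊔ ℓ₁ ⊔ ℓ₂)
  InLevel : ℕ → Carrier → Set (c ⊔ ℓ₁ ⊔ ℓ₂)
  Removed zero    x = Level.Lift _ ⊥
  Removed (suc i) x = Removed i x ⊎ InLevel i x
  InLevel i x = ¬ Removed i x × (∀ y → ¬ Removed i y → ¬ (x <ₚ y))

  -- The linearisation: the nonempty levels, identified with their index i.
  Lin : Set (c ⊔ ℓ₁ ⊔ ℓ₂)
  Lin = Σ ℕ λ i → ∃ λ x → InLevel i x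

  _⪯_ : Lin → Lin → Set
  a ⪯ b = proj₁ b ≤ℕ proj₁ a

Pointwise : ∀ {a ℓ} {A : Set a} (R : A → A → Set ℓ) {n : ℕ} →
            (Fin n → A) → (Fin n → A) → Set ℓ
Pointwise R x y = ∀ i → R (x i) (y i)

Antitonic : ∀ {c₁ ℓ₁ ℓ₂ c₂ ℓ₃ ℓ₄} (L : FinitePoset c₁ ℓ₁ ℓ₂) (M : FinitePoset c₂ ℓ₃ ℓ₄)
            (n : ℕ) → ((Fin n → FinitePoset.Carrier L) → FinitePoset.Carrier M) →
            Set (c₁ ⊔ ℓ₂ ⊔ ℓ₄)
Antitonic L M n f =
  ∀ x y → Pointwise (FinitePoset._≤_ L) x y → FinitePoset._≤_ M (f y) (f x)

module _ {c₁ ℓ₁ ℓ₂ c₂ ℓ₃ ℓ₄} (L : FinitePoset c₁ ℓ₁ ℓ₂) (M : FinitePoset c₂ ℓ₃ ℓ₄)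
         {n : ℕ} (f : (Fin n → FinitePoset.Carrier L) → FinitePoset.Carrier M) where

  -- k ∈ { [f(y_1,…,y_n)] : y_i ∈ [x_i] }, where [x_i] = level a i
  InImage : (Fin n → Lin L) → ℕ → Set (c₁ ⊔ ℓ₁ ⊔ ℓ₂ ⊔ c₂ ⊔ ℓ₃ ⊔ ℓ₄)
  InImage a k = ∃ λ (y : Fin n → FinitePoset.Carrier L) →
                  (∀ i → InLevel L (proj₁ (a i)) (y i)) × InLevel M k (f y)

  -- IsTilde a m  :⇔  m = f̃(a) = min of that set in (𝓜, ⪯_𝓜);
  -- since [u] ⪯ [v] iff index v ≤ index u, the ⪯-minimum is the
  -- element of largest level index.
  IsTilde : (Fin n → Lin L) → Lin M → Set (c₁ ⊔ ℓ₁ ⊔ ℓ₂ ⊔ c₂ ⊔ ℓ₃ ⊔ ℓ₄)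
  IsTilde a m = InImage a (proj₁ m) × (∀ k → InImage a k → k ≤ℕ proj₁ m)

  TildeAntitonic : Set (c₁ ⊔ ℓ₁ ⊔ ℓ₂ ⊔ c₂ ⊔ ℓ₃ ⊔ ℓ₄)
  TildeAntitonic = ∀ (a b : Fin n → Lin L) (ma mb : Lin M) →
                   Pointwise (_⪯_ L) a b → IsTilde a ma → IsTilde b mb →
                   _⪯_ M mb ma

module Submission where

-- Let y be a witness for f̃(a) = m_a, i.e. y_i ∈ L_{a_i}
-- and f(y) ∈ M_{m_a}, and let b ⪯ a componentwise (b_i ≤ a_i as indices).
--   1. y_i is not removed before level b_i, so above y_i there is an element
--      z_i of level exactly b_i (climb while some larger unremoved element
--      exists; finiteness makes this terminate).
--   2. Antitonicity gives f(z) ≤ f(y); an element below a level-m_a element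
--      has not been removed before level m_a, so f(z) ∈ M_k for some k ≥ m_a.
--   3. Hence k belongs to the set minimised by f̃(b) = m_b, so m_a ≤ k ≤ m_b,
--      which is m_b ⪯ m_a.
-- Equality in a poset is not decidable, so steps 1 and 2 are proved in the
-- double-negation monad; the conclusion is an inequality of natural numbers,
-- which is decidable and hence stable under double negation.

open import Defs
open import Data.Nat using (ℕ; zero; suc; pred; _≤′_; ≤′-refl; ≤′-step; _≤?_)
  renaming (_≤_ to _≤ℕ_; _<_ to _<ℕ_)
open import Data.Nat.Properties using (≤⇒≤′; ≤-refl; ≤-trans; <⇒≤; m≤n⇒m≤1+n)
open import Data.Fin using (Fin)
open import Data.Fin.Properties using (sequence)
open import Data.Product using (∃; _×_; _,_; proj₁; proj₂)
open import Data.Sum using (inj₁; inj₂)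
open import Data.List using (List; []; _∷_; length)
open import Data.List.Properties using (length-removeAt)
open import Data.List.Relation.Unary.Any using (Any; here; there; _─_; index)
open import Effect.Monad using (RawMonad)
open import Level using (lift)
open import Relation.Nullary using (¬_; yes; no)
open import Relation.Nullary.Negation using (¬¬-Monad; ¬¬-map; negated-stable; contradiction)
open import Relation.Nullary.Decidable using (decidable-stable; ¬¬-excluded-middle)
open import Relation.Binary.PropositionalEquality using (_≡_; cong)
  renaming (refl to ≡-refl; trans to ≡-trans)
import Relation.Binary.Properties.Poset as PosetProperties

-- Bind and return of the double-negation monad, level-heterogeneous so that
-- statements about L and about M can be chained in one do-block.
module _ {a b} {A : Set a} {B : Set b} where

  _>>=_ : ¬ ¬ A → (A → ¬ ¬ B) → ¬ ¬ B
  m >>= k = negated-stable (¬¬-map k m)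

return : ∀ {a} {A : Set a} → A → ¬ ¬ A
return x = contradiction x

module Levels {c ℓ₁ ℓ₂} (P : FinitePoset c ℓ₁ ℓ₂) where
  open FinitePoset P
  open PosetProperties poset using (_<_; <-trans; <-respˡ-≈; <-respʳ-≈)

  removed-mono : ∀ {j k x} → j ≤ℕ k → Removed P j x → Removed P k x
  removed-mono j≤k = go (≤⇒≤′ j≤k)
    where
      go : ∀ {j k x} → j ≤′ k → Removed P j x → Removed P k x
      go ≤′-refl      r = r
      go (≤′-step j≤k) r = inj₁ (go j≤k r)

  removed⇒earlier-level : ∀ K {w} → Removed P K w → ∃ λ k → k <ℕ K × InLevel P k w
  removed⇒earlier-level zero    (lift ())
  removed⇒earlier-level (suc K) (inj₂ w∈K) = K , ≤-refl , w∈K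
  removed⇒earlier-level (suc K) (inj₁ r) with removed⇒earlier-level K r
  ... | k , k<K , w∈k = k , m≤n⇒m≤1+n k<K , w∈k

  removed-resp : ∀ k {x y} → x ≈ y → Removed P k x → Removed P k y
  inLevel-resp : ∀ k {x y} → x ≈ y → InLevel P k x → InLevel P k y

  removed-resp (suc k) x≈y (inj₁ r)   = inj₁ (removed-resp k x≈y r)
  removed-resp (suc k) x≈y (inj₂ x∈k) = inj₂ (inLevel-resp k x≈y x∈k)

  inLevel-resp k x≈y (x-kept , x-maximal) =
    (λ ry → x-kept (removed-resp k (Eq.sym x≈y) ry)) ,
    (λ u u-kept y<u → x-maximal u u-kept (<-respˡ-≈ (Eq.sym x≈y) y<u))

  drop-head : ∀ {y e} {S : List Carrier} → ¬ y ≈ e → Any (y ≈_) (e ∷ S) → Any (y ≈_) S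
  drop-head y≉e (here y≈e) = contradiction y≈e y≉e
  drop-head y≉e (there p)  = p

  ─-keeps : ∀ {z v} (S : List Carrier) (p : Any (z ≈_) S) →
            ¬ v ≈ z → Any (v ≈_) S → Any (v ≈_) (S ─ p)
  ─-keeps (_ ∷ _) (here z≈e) v≉z (here v≈e) = contradiction (Eq.trans v≈e (Eq.sym z≈e)) v≉z
  ─-keeps (_ ∷ _) (here _)   v≉z (there q)  = q
  ─-keeps (_ ∷ _) (there p)  v≉z (here v≈e) = here v≈e
  ─-keeps (_ ∷ S) (there p)  v≉z (there q)  = there (─-keeps S p v≉z q)

  -- Induction on S: if
  -- its head e is a surviving element above x, climb from e, else drop e.
  climb : ∀ j (S : List Carrier) {x} → ¬ Removed P j x →
          (∀ y → x < y → ¬ Removed P j y → Any (y ≈_) S) →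
          ¬ ¬ (∃ λ z → x ≤ z × InLevel P j z)
  climb j [] {x} x-kept covers = return (x , refl , x-kept , λ y y-kept x<y → none (covers y x<y y-kept))
    where
      none : ∀ {y} → ¬ Any (y ≈_) []
      none ()
  climb j (e ∷ S) {x} x-kept covers = ¬¬-excluded-middle >>= λ
    { (no e-not-above) → climb j S x-kept λ y x<y y-kept →
        drop-head (λ y≈e → e-not-above (<-respʳ-≈ y≈e x<y , λ re → y-kept (removed-resp j (Eq.sym y≈e) re)))
                  (covers y x<y y-kept)
    ; (yes (x<e , e-kept)) → do
        (z , e≤z , z∈j) ← climb j S e-kept λ y e<y y-kept →
          drop-head (λ y≈e → proj₂ e<y (Eq.sym y≈e)) (covers y (<-trans x<e e<y) y-kept)
        return (z , trans (proj₁ x<e) e≤z , z∈j) }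

  level-above : ∀ j {x} → ¬ Removed P j x → ¬ ¬ (∃ λ z → x ≤ z × InLevel P j z)
  level-above j x-kept = climb j elements x-kept (λ y _ _ → complete y)

  -- If w
  -- is not in level k, level k contains some z, which disappears from the
  -- list of survivors at stage k+1; recurse with the shorter list.
  descend : ∀ N (S : List Carrier) → length S ≡ N → ∀ k {w} →
            (∀ v → ¬ Removed P k v → Any (v ≈_) S) → ¬ Removed P k w →
            ¬ ¬ (∃ λ k' → k ≤ℕ k' × InLevel P k' w)
  descend zero [] _ k {w} covers w-kept = contradiction (covers w w-kept) none
    where
      none : ¬ Any (w ≈_) []
      none ()
  descend (suc N) S len k {w} covers w-kept = ¬¬-excluded-middle >>= λ
    { (yes w∈k) → return (k , ≤-refl , w∈k)
    ; (no w∉k) → do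
        (z , _ , z∈k) ← level-above k w-kept
        let z∈S = covers z (proj₁ z∈k)
            covers′ : ∀ v → ¬ Removed P (suc k) v → Any (v ≈_) (S ─ z∈S)
            covers′ v v-kept = ─-keeps S z∈S
              (λ v≈z → v-kept (inj₂ (inLevel-resp k (Eq.sym v≈z) z∈k)))
              (covers v (λ r → v-kept (inj₁ r)))
        (k' , k<k' , w∈k') ← descend N (S ─ z∈S)
          (≡-trans (length-removeAt S (index z∈S)) (cong pred len)) (suc k) covers′
          (λ { (inj₁ r) → w-kept r ; (inj₂ w∈k) → w∉k w∈k })
        return (k' , <⇒≤ k<k' , w∈k') }

  in-some-level : ∀ k {w} → ¬ Removed P k w → ¬ ¬ (∃ λ k' → k ≤ℕ k' × InLevel P k' w)
  in-some-level k = descend _ elements ≡-refl k (λ v _ → complete v)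

  -- Anything below an element of level K survives to stage K: were w in an
  -- earlier level k, then v (surviving to stage k) would be either equal to
  -- w, hence in level k too, or strictly above w, contradicting maximality.
  below-level-survives : ∀ K {w v} → w ≤ v → InLevel P K v → ¬ Removed P K w
  below-level-survives K {w} {v} w≤v (v-kept , _) r with removed⇒earlier-level K r
  ... | k , k<K , (w-kept , w-maximal) = ¬¬-excluded-middle λ
    { (yes w≈v) → v-kept (removed-mono k<K (inj₂ (inLevel-resp k w≈v (w-kept , w-maximal))))
    ; (no w≉v)  → w-maximal v (λ rv → v-kept (removed-mono (<⇒≤ k<K) rv)) (w≤v , w≉v) }

proposition11 : ∀ {c₁ ℓ₁ ℓ₂ c₂ ℓ₃ ℓ₄} (L : FinitePoset c₁ ℓ₁ ℓ₂) (M : FinitePoset c₂ ℓ₃ ℓ₄)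
    (n : ℕ) (f : (Fin n → FinitePoset.Carrier L) → FinitePoset.Carrier M) →
    Antitonic L M n f → TildeAntitonic L M f
proposition11 L M n f antitonic a b ma mb b⪯a ((y , y∈a , fy∈ma) , _) (_ , mb-maximal) =
  decidable-stable (proj₁ ma ≤? proj₁ mb) do
    -- step 1: z_i ≥ y_i with z_i in level b_i
    Z ← sequence (RawMonad.rawApplicative ¬¬-Monad)
          (λ i → LL.level-above (proj₁ (b i)) (y-survives i))
    let z = λ i → proj₁ (Z i)
    -- step 2: f(z) ≤ f(y) lies in some level k ≥ m_a
    (k , ma≤k , fz∈k) ← LM.in-some-level (proj₁ ma)
      (LM.below-level-survives (proj₁ ma) (antitonic y z (λ i → proj₁ (proj₂ (Z i)))) fy∈ma)
    -- step 3: k is a candidate for f̃(b), so k ≤ m_b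
    return (≤-trans ma≤k (mb-maximal k (z , (λ i → proj₂ (proj₂ (Z i))) , fz∈k)))
  where
    module LL = Levels L
    module LM = Levels M

    y-survives : ∀ i → ¬ Removed L (proj₁ (b i)) (y i)
    y-survives i r = proj₁ (y∈a i) (LL.removed-mono (b⪯a i) r)
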